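{- Let $Y_0=\{y_k\}_{k\ge0}$, $\mathrm{H}^-_{y_{s_1}\cdots y_{s_r}}(N)=\sum_{N\ge n_1>\cdots>n_r>0}n_1^{s_1}\cdots n_r^{s_r}$, $\mathrm{H}^-_{1_{Y_0^*}}=1$, extended linearly to $P\in\mathbb{Q}\langle Y_0\rangle$; each $\mathrm{H}^-_P$ is a polynomial function of $N$, and for $\mathrm{H}^-_P\not\equiv0$ let $C^-_P$ denote its leading coefficient (so $\mathrm{H}^-_P(N)\sim C^-_PN^{n(P)}$ as $N\to\infty$). Then: (1) For all words $w,v\in Y_0^*$, $C^-_wC^-_v=C^-_{w\sqcup\!\sqcup v}=C^-_{w\ast v}$. (2) For all $P,Q\in\mathbb{Q}\langle Y_0\rangle\setminus\ker\mathrm{H}^-_\bullet$, $C^-_PC^-_Q=C^-_{P\ast Q}$, and $\mathbb{Q}\langle Y_0\rangle\setminus\ker\mathrm{H}^-_\bullet$ is a $\ast$-multiplicative monoid containing $Y_0^*$.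
   Context: Shuffle: $w\sqcup\!\sqcup1=1\sqcup\!\sqcup w=w$, $xu\sqcup\!\sqcup yv=x(u\sqcup\!\sqcup yv)+y(xu\sqcup\!\sqcup v)$ for letters $x,y\in Y_0$. Stuffle: $w\ast1=1\ast w=w$, $y_iu\ast y_jv=y_j(y_iu\ast v)+y_i(u\ast y_jv)+y_{i+j}(u\ast v)$. $\mathrm{H}^-_\bullet:P\mapsto\mathrm{H}^-_P$. -}

module Defs where

open import Data.Nat as ℕ using (ℕ; zero; suc)
open import Data.List using (List; []; _∷_; _++_; map; concatMap; _∷ʳ_)
open import Data.Product using (Σ; _×_; _,_)
open import Data.Rational as ℚ using (ℚ; 0ℚ; 1ℚ)
open import Relation.Binary.PropositionalEquality using (_≡_; _≢_)
open import Relation.Nullary using (¬_)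
open import Data.Integer using (+_)

-- Letters y_k of Y₀ are indexed by k : ℕ; a word y_{s₁}⋯y_{s_r} is the list s₁ ∷ … ∷ s_r.
Word : Set
Word = List ℕ

-- An element of ℚ⟨Y₀⟩, represented as a formal finite ℚ-linear combination of words.
-- All notions below (H⁻, kernel, products) are linear/bilinear, hence independent of
-- the representative.
Poly : Set
Poly = List (ℚ × Word)

word : Word → Poly
word w = (1ℚ , w) ∷ []

1P : Poly
1P = word []

prefix : ℕ → Poly → Poly
prefix x = map (λ { (c , w) → (c , x ∷ w) })

_⧢_ : Word → Word → Poly
[] ⧢ v = word v
(x ∷ u) ⧢ [] = word (x ∷ u)
(x ∷ u) ⧢ (y ∷ v) = prefix x (u ⧢ (y ∷ v)) ++ prefix y ((x ∷ u) ⧢ v)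

_⋆_ : Word → Word → Poly
[] ⋆ v = word v
(i ∷ u) ⋆ [] = word (i ∷ u)
(i ∷ u) ⋆ (j ∷ v) =
  prefix j ((i ∷ u) ⋆ v) ++ (prefix i (u ⋆ (j ∷ v)) ++ prefix (i ℕ.+ j) (u ⋆ v))

_⋆ᴾ_ : Poly → Poly → Poly
P ⋆ᴾ Q = concatMap (λ { (a , w) →
           concatMap (λ { (b , v) → map (λ { (c , u) → (a ℚ.* b ℚ.* c , u) }) (w ⋆ v) }) Q }) P

sumTo : ℕ → (ℕ → ℕ) → ℕ
sumTo zero f = 0
sumTo (suc N) f = sumTo N f ℕ.+ f (suc N)

-- H⁻_{y_{s₁}⋯y_{s_r}}(N) = Σ_{N ≥ n₁ > ⋯ > n_r > 0} n₁^{s₁} ⋯ n_r^{s_r},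
-- written as the nested sum Σ_{n₁=1}^{N} n₁^{s₁} H⁻_{y_{s₂}⋯y_{s_r}}(n₁ - 1); H⁻_1 = 1.
Hw : Word → ℕ → ℕ
Hw [] N = 1
Hw (s ∷ w) N = sumTo N (λ n → (n ℕ.^ s) ℕ.* Hw w (n ℕ.∸ 1))

H⁻ : Poly → ℕ → ℚ
H⁻ [] N = 0ℚ
H⁻ ((c , w) ∷ P) N = c ℚ.* (+ Hw w N ℚ./ 1) ℚ.+ H⁻ P N

InKer : Poly → Set
InKer P = (N : ℕ) → H⁻ P N ≡ 0ℚ

evalPoly : List ℚ → ℕ → ℚ
evalPoly [] N = 0ℚ
evalPoly (a ∷ as) N = a ℚ.+ (+ N ℚ./ 1) ℚ.* evalPoly as N

LeadCoeff : (ℕ → ℚ) → ℚ → Set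
LeadCoeff f c = Σ (List ℚ) λ as → (c ≢ 0ℚ) × ((N : ℕ) → f N ≡ evalPoly (as ∷ʳ c) N)

-- On ℕ, H⁻_w is a polynomial in N of degree weight w = Σ (sᵢ + 1): summing nˢ · p(n − 1) for a polynomial p
-- of degree d raises the degree to s + d + 1 and divides the leading coefficient by s + d + 1, because
-- Σ_{n ≤ N} nᵉ = N^{e+1}/(e+1) + (lower terms) by telescoping n^{e+1} − (n − 1)^{e+1}.  Leading coefficients
-- are well defined since a polynomial vanishing on ℕ is zero.  H⁻ turns the stuffle into the pointwise product
-- (the three terms of ⋆ split a product of two nested sums according to their outermost indices), so leading
-- coefficients multiply along ⋆ and its bilinear extension, and a product of nonvanishing polynomials does not
-- vanish.  For the shuffle, all words of w ⧢ v have weight weight w + weight v, so the leading coefficient of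
-- H⁻_{w⧢v} is Σ c_u C⁻_u, and the recursion of ⧢ with 1/(ab) = (1/a + 1/b)/(a + b) turns this into C⁻_w C⁻_v.

module Submission where

open import Defs
open import Algebra.Bundles using (Ring)
open import Data.Empty using (⊥-elim)
import Data.Integer as ℤ
import Data.Integer.Properties as ℤ
open import Data.List using (List; []; _∷_; length; _∷ʳ_; _++_; map; concatMap)
open import Data.List.Relation.Unary.All using (All; []; _∷_)
open import Data.List.Relation.Unary.All.Properties using (++⁺)
open import Data.Nat as ℕ using (ℕ; zero; suc; _≤_; z≤n; s≤s)
import Data.Nat.Properties as ℕ
import Data.Nat.Tactic.RingSolver as ℕ-Solver
open import Data.Nat.Coprimality using (1-coprimeTo) renaming (sym to coprime-sym)
open import Data.Product using (Σ; _×_; _,_; proj₂)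
open import Data.Rational using (ℚ; _+_; _*_; -_; _-_; 0ℚ; 1ℚ; 1/_; _/_; mkℚ; ≢-nonZero)
open import Data.Rational.Properties
open import Algebra.Properties.Semiring.Exp (Ring.semiring +-*-ring) using (_^_; ^-homo-*)
open import Data.Sum using (_⊎_; inj₁; inj₂)
open import Level using (0ℓ)
open import Relation.Binary using (tri<; tri≈; tri>)
open import Relation.Binary.PropositionalEquality
open import Relation.Nullary using (¬_; yes; no)
open import Relation.Nullary.Decidable using (dec⇒maybe)
open import Tactic.RingSolver using (solve-∀)
open import Tactic.RingSolver.Core.AlmostCommutativeRing using (AlmostCommutativeRing; fromCommutativeRing)

ℚ-ring : AlmostCommutativeRing 0ℓ 0ℓ
ℚ-ring = fromCommutativeRing +-*-commutativeRing (λ x → dec⇒maybe (0ℚ ≟ x))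

-- The embedding ℕ → ℚ is kept opaque so that Agda never starts normalising gcds.
opaque
  ι : ℕ → ℚ
  ι n = ℤ.+ n / 1

  ι≡/1 : ∀ n → ι n ≡ ℤ.+ n / 1
  ι≡/1 n = refl

  ι-0 : ι 0 ≡ 0ℚ
  ι-0 = refl

  ι-1 : ι 1 ≡ 1ℚ
  ι-1 = refl

  private
    ιᶜ : ℕ → ℚ
    ιᶜ n = mkℚ (ℤ.+ n) 0 (coprime-sym (1-coprimeTo n))

    ι≡ιᶜ : ∀ n → ι n ≡ ιᶜ n
    ι≡ιᶜ n = normalize-coprime (coprime-sym (1-coprimeTo n))

  ι-+ : ∀ m n → ι (m ℕ.+ n) ≡ ι m + ι n
  ι-+ m n rewrite ι≡ιᶜ m | ι≡ιᶜ n =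
    cong (_/ 1) (sym (cong₂ ℤ._+_ (ℤ.*-identityʳ (ℤ.+ m)) (ℤ.*-identityʳ (ℤ.+ n))))

  ι-* : ∀ m n → ι (m ℕ.* n) ≡ ι m * ι n
  ι-* m n rewrite ι≡ιᶜ m | ι≡ιᶜ n = cong (_/ 1) (ℤ.pos-* m n)

  1/suc : ℕ → ℚ
  1/suc n = 1/ ιᶜ (suc n)

  ι-suc*1/suc : ∀ n → ι (suc n) * 1/suc n ≡ 1ℚ
  ι-suc*1/suc n rewrite ι≡ιᶜ (suc n) = *-inverseʳ (ιᶜ (suc n))

ι-suc : ∀ n → ι (suc n) ≡ ι n + 1ℚ
ι-suc n = trans (ι-+ 1 n) (trans (cong₂ _+_ ι-1 refl) (+-comm 1ℚ (ι n)))

ι-suc-1 : ∀ n → ι (suc n) - 1ℚ ≡ ι n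
ι-suc-1 n = trans (cong (_- 1ℚ) (ι-suc n)) (shift-back (ι n))
  where
  shift-back : ∀ y → (y + 1ℚ) - 1ℚ ≡ y
  shift-back = solve-∀ ℚ-ring

ι-^ : ∀ m k → ι (m ℕ.^ k) ≡ ι m ^ k
ι-^ m zero = ι-1
ι-^ m (suc k) = trans (ι-* m (m ℕ.^ k)) (cong (ι m *_) (ι-^ m k))

p*q≡0⇒q≡0 : ∀ {p q} → p ≢ 0ℚ → p * q ≡ 0ℚ → q ≡ 0ℚ
p*q≡0⇒q≡0 {p} {q} p≢0 pq≡0 = begin
  q                ≡⟨ sym (*-identityˡ q) ⟩
  1ℚ * q           ≡⟨ cong (_* q) (sym (*-inverseˡ p)) ⟩
  (1/ p) * p * q   ≡⟨ *-assoc (1/ p) p q ⟩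
  (1/ p) * (p * q) ≡⟨ cong ((1/ p) *_) pq≡0 ⟩
  (1/ p) * 0ℚ      ≡⟨ *-zeroʳ (1/ p) ⟩
  0ℚ               ∎
  where
  open ≡-Reasoning
  instance _ = ≢-nonZero p≢0

p*q≢0 : ∀ {p q} → p ≢ 0ℚ → q ≢ 0ℚ → p * q ≢ 0ℚ
p*q≢0 p≢0 q≢0 pq≡0 = q≢0 (p*q≡0⇒q≡0 p≢0 pq≡0)

ι-suc≢0 : ∀ n → ι (suc n) ≢ 0ℚ
ι-suc≢0 n ι≡0 = 1≢0 (trans (sym (ι-suc*1/suc n)) (trans (cong (_* 1/suc n) ι≡0) (*-zeroˡ (1/suc n))))

1/suc≢0 : ∀ n → 1/suc n ≢ 0ℚ
1/suc≢0 n 1/suc≡0 = 1≢0 (trans (sym (ι-suc*1/suc n)) (trans (cong (ι (suc n) *_) 1/suc≡0) (*-zeroʳ (ι (suc n)))))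

p-q≡0⇒p≡q : ∀ {p q} → p + - 1ℚ * q ≡ 0ℚ → p ≡ q
p-q≡0⇒p≡q {p} {q} p-q≡0 = begin
  p                       ≡⟨ identity p q ⟩
  (p + - 1ℚ * q) + q      ≡⟨ cong (_+ q) p-q≡0 ⟩
  0ℚ + q                  ≡⟨ +-identityˡ q ⟩
  q                       ∎
  where
  open ≡-Reasoning
  identity : ∀ p q → p ≡ (p + - 1ℚ * q) + q
  identity = solve-∀ ℚ-ring

p≡q⇒p-q≡0 : ∀ {p q} → p ≡ q → p + - 1ℚ * q ≡ 0ℚ
p≡q⇒p-q≡0 {p} refl = identity p
  where
  identity : ∀ p → p + - 1ℚ * p ≡ 0ℚ
  identity = solve-∀ ℚ-ring

reciprocal-sum : ∀ {a b p q r} → a * p ≡ 1ℚ → b * q ≡ 1ℚ → (a + b) * r ≡ 1ℚ → q * r + p * r ≡ p * q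
reciprocal-sum {a} {b} {p} {q} {r} ap≡1 bq≡1 [a+b]r≡1 = begin
  q * r + p * r                        ≡⟨ sym (cong₂ _+_ (*-identityˡ (q * r)) (*-identityˡ (p * r))) ⟩
  1ℚ * (q * r) + 1ℚ * (p * r)          ≡⟨ cong₂ (λ u v → u * (q * r) + v * (p * r)) (sym ap≡1) (sym bq≡1) ⟩
  a * p * (q * r) + b * q * (p * r)    ≡⟨ regroup a b p q r ⟩
  p * q * ((a + b) * r)                ≡⟨ cong (p * q *_) [a+b]r≡1 ⟩
  p * q * 1ℚ                           ≡⟨ *-identityʳ (p * q) ⟩
  p * q                                ∎
  where
  open ≡-Reasoning
  regroup : ∀ a b p q r → a * p * (q * r) + b * q * (p * r) ≡ p * q * ((a + b) * r)
  regroup = solve-∀ ℚ-ring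

m*p+r≡t⇒p≡[t-r]/m : ∀ {m i p r t} → m * i ≡ 1ℚ → m * p + r ≡ t → p ≡ i * (t + - 1ℚ * r)
m*p+r≡t⇒p≡[t-r]/m {m} {i} {p} {r} {t} mi≡1 mp+r≡t = begin
  p                              ≡⟨ sym (*-identityˡ p) ⟩
  1ℚ * p                         ≡⟨ cong (_* p) (sym mi≡1) ⟩
  m * i * p                      ≡⟨ identity m i p r ⟩
  i * ((m * p + r) + - 1ℚ * r)   ≡⟨ cong (λ s → i * (s + - 1ℚ * r)) mp+r≡t ⟩
  i * (t + - 1ℚ * r)             ∎
  where
  open ≡-Reasoning
  identity : ∀ m i p r → m * i * p ≡ i * ((m * p + r) + - 1ℚ * r)
  identity = solve-∀ ℚ-ring

-- Polynomial functions on ℚ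

-- Horner's scheme: f has degree < d iff f = a₀ + x (a₁ + x (⋯ + x a_{d-1})).
data DegreeBelow : ℕ → (ℚ → ℚ) → Set where
  deg-0   : ∀ {f} → (∀ x → f x ≡ 0ℚ) → DegreeBelow 0 f
  deg-suc : ∀ {d f g} a → DegreeBelow d g → (∀ x → f x ≡ a + x * g x) → DegreeBelow (suc d) f

DegreeBelow-≗ : ∀ {d f g} → (∀ x → f x ≡ g x) → DegreeBelow d g → DegreeBelow d f
DegreeBelow-≗ f≗g (deg-0 g≗0) = deg-0 (λ x → trans (f≗g x) (g≗0 x))
DegreeBelow-≗ f≗g (deg-suc a G g≗) = deg-suc a G (λ x → trans (f≗g x) (g≗ x))

DegreeBelow-0 : ∀ d → DegreeBelow d (λ _ → 0ℚ)
DegreeBelow-0 zero = deg-0 (λ _ → refl)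
DegreeBelow-0 (suc d) = deg-suc 0ℚ (DegreeBelow-0 d) (λ x → sym (trans (+-identityˡ (x * 0ℚ)) (*-zeroʳ x)))

DegreeBelow-mono : ∀ {d e f} → d ≤ e → DegreeBelow d f → DegreeBelow e f
DegreeBelow-mono {e = e} _ (deg-0 f≗0) = DegreeBelow-≗ f≗0 (DegreeBelow-0 e)
DegreeBelow-mono (s≤s d≤e) (deg-suc a G f≗) = deg-suc a (DegreeBelow-mono d≤e G) f≗

DegreeBelow-const : ∀ c → DegreeBelow 1 (λ _ → c)
DegreeBelow-const c = deg-suc c (DegreeBelow-0 0) (λ x → sym (trans (cong (c +_) (*-zeroʳ x)) (+-identityʳ c)))

DegreeBelow-x* : ∀ {d f} → DegreeBelow d f → DegreeBelow (suc d) (λ x → x * f x)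
DegreeBelow-x* F = deg-suc 0ℚ F (λ x → sym (+-identityˡ _))

DegreeBelow-+ : ∀ {d f g} → DegreeBelow d f → DegreeBelow d g → DegreeBelow d (λ x → f x + g x)
DegreeBelow-+ (deg-0 f≗0) (deg-0 g≗0) = deg-0 (λ x → trans (cong₂ _+_ (f≗0 x) (g≗0 x)) (+-identityʳ 0ℚ))
DegreeBelow-+ (deg-suc a F f≗) (deg-suc b G g≗) =
  deg-suc (a + b) (DegreeBelow-+ F G) (λ x → trans (cong₂ _+_ (f≗ x) (g≗ x)) (regroup a b x _ _))
  where
  regroup : ∀ a b x p q → (a + x * p) + (b + x * q) ≡ (a + b) + x * (p + q)
  regroup = solve-∀ ℚ-ring

DegreeBelow-scale : ∀ {d f} k → DegreeBelow d f → DegreeBelow d (λ x → k * f x)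
DegreeBelow-scale k (deg-0 f≗0) = deg-0 (λ x → trans (cong (k *_) (f≗0 x)) (*-zeroʳ k))
DegreeBelow-scale k (deg-suc a F f≗) =
  deg-suc (k * a) (DegreeBelow-scale k F) (λ x → trans (cong (k *_) (f≗ x)) (regroup k a x _))
  where
  regroup : ∀ k a x p → k * (a + x * p) ≡ k * a + x * (k * p)
  regroup = solve-∀ ℚ-ring

DegreeBelow-* : ∀ {d e f g} → DegreeBelow d f → DegreeBelow e g → DegreeBelow (d ℕ.+ e) (λ x → f x * g x)
DegreeBelow-* {e = e} {g = g} (deg-0 f≗0) _ =
  DegreeBelow-≗ (λ x → trans (cong (_* g x) (f≗0 x)) (*-zeroˡ (g x))) (DegreeBelow-0 e)
DegreeBelow-* {suc d} {e} {g = g} (deg-suc a F f≗) G =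
  DegreeBelow-≗ (λ x → trans (cong (_* g x) (f≗ x)) (regroup a x _ (g x)))
    (DegreeBelow-+ (DegreeBelow-mono (ℕ.m≤n+m e (suc d)) (DegreeBelow-scale a G)) (DegreeBelow-x* (DegreeBelow-* F G)))
  where
  regroup : ∀ a x p q → (a + x * p) * q ≡ a * q + x * (p * q)
  regroup = solve-∀ ℚ-ring

DegreeBelow-x^* : ∀ {e f} k → DegreeBelow e f → DegreeBelow (k ℕ.+ e) (λ x → x ^ k * f x)
DegreeBelow-x^* zero F = DegreeBelow-≗ (λ x → *-identityˡ _) F
DegreeBelow-x^* (suc k) F = DegreeBelow-≗ (λ x → *-assoc x _ _) (DegreeBelow-x* (DegreeBelow-x^* k F))

DegreeBelow-monomial : ∀ c d → DegreeBelow (suc d) (λ x → c * x ^ d)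
DegreeBelow-monomial c zero = DegreeBelow-≗ (λ x → *-identityʳ c) (DegreeBelow-const c)
DegreeBelow-monomial c (suc d) = DegreeBelow-≗ (λ x → regroup c x (x ^ d)) (DegreeBelow-x* (DegreeBelow-monomial c d))
  where
  regroup : ∀ c x p → c * (x * p) ≡ x * (c * p)
  regroup = solve-∀ ℚ-ring

DegreeBelow-shift : ∀ {d f} t → DegreeBelow d f → DegreeBelow d (λ x → f (x + t))
DegreeBelow-shift t (deg-0 f≗0) = deg-0 (λ x → f≗0 (x + t))
DegreeBelow-shift {suc d} t (deg-suc {g = g} a G f≗) =
  DegreeBelow-≗ (λ x → trans (f≗ (x + t)) (regroup a t x (g (x + t))))
    (DegreeBelow-+ (DegreeBelow-+ (DegreeBelow-mono (s≤s z≤n) (DegreeBelow-const a))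
                                  (DegreeBelow-mono (ℕ.n≤1+n d) (DegreeBelow-scale t G[+t])))
                   (DegreeBelow-x* G[+t]))
  where
  G[+t] = DegreeBelow-shift t G
  regroup : ∀ a t x p → a + (x + t) * p ≡ (a + t * p) + x * p
  regroup = solve-∀ ℚ-ring

-- The coefficient c may be 0.
record LeadingTerm (d : ℕ) (c : ℚ) (f : ℚ → ℚ) : Set where
  constructor leading
  field
    lower        : ℚ → ℚ
    lower-degree : DegreeBelow d lower
    expansion    : ∀ x → f x ≡ c * x ^ d + lower x

LeadingTerm-≗ : ∀ {d c f g} → (∀ x → f x ≡ g x) → LeadingTerm d c g → LeadingTerm d c f
LeadingTerm-≗ f≗g (leading r R g≗) = leading r R λ x → trans (f≗g x) (g≗ x)

LeadingTerm⇒DegreeBelow : ∀ {d c f} → LeadingTerm d c f → DegreeBelow (suc d) f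
LeadingTerm⇒DegreeBelow {d} {c} (leading r R f≗) =
  DegreeBelow-≗ f≗ (DegreeBelow-+ (DegreeBelow-monomial c d) (DegreeBelow-mono (ℕ.n≤1+n d) R))

LeadingTerm-+lower : ∀ {d c f g} → LeadingTerm d c f → DegreeBelow d g → LeadingTerm d c (λ x → f x + g x)
LeadingTerm-+lower {d} {c} {g = g} (leading r R f≗) G =
  leading (λ x → r x + g x) (DegreeBelow-+ R G) λ x → trans (cong (_+ g x) (f≗ x)) (+-assoc (c * x ^ d) (r x) (g x))

LeadingTerm-+ : ∀ {d c c′ f g} → LeadingTerm d c f → LeadingTerm d c′ g →
                LeadingTerm d (c + c′) (λ x → f x + g x)
LeadingTerm-+ {d} {c} {c′} (leading r R f≗) (leading s S g≗) =
  leading (λ x → r x + s x) (DegreeBelow-+ R S)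
  λ x → trans (cong₂ _+_ (f≗ x) (g≗ x)) (regroup c c′ (x ^ d) (r x) (s x))
  where
  regroup : ∀ c c′ p a b → (c * p + a) + (c′ * p + b) ≡ (c + c′) * p + (a + b)
  regroup = solve-∀ ℚ-ring

LeadingTerm-scale : ∀ {d c f} k → LeadingTerm d c f → LeadingTerm d (k * c) (λ x → k * f x)
LeadingTerm-scale {d} {c} k (leading r R f≗) =
  leading (λ x → k * r x) (DegreeBelow-scale k R) λ x → trans (cong (k *_) (f≗ x)) (regroup k c (x ^ d) (r x))
  where
  regroup : ∀ k c p a → k * (c * p + a) ≡ k * c * p + k * a
  regroup = solve-∀ ℚ-ring

LeadingTerm-x* : ∀ {d c f} → LeadingTerm d c f → LeadingTerm (suc d) c (λ x → x * f x)
LeadingTerm-x* {d} {c} (leading r R f≗) =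
  leading (λ x → x * r x) (DegreeBelow-x* R) λ x → trans (cong (x *_) (f≗ x)) (regroup c x (x ^ d) (r x))
  where
  regroup : ∀ c x p a → x * (c * p + a) ≡ c * (x * p) + x * a
  regroup = solve-∀ ℚ-ring

LeadingTerm-x^* : ∀ {d c f} k → LeadingTerm d c f → LeadingTerm (k ℕ.+ d) c (λ x → x ^ k * f x)
LeadingTerm-x^* {d} {c} {f} k (leading r R f≗) = leading (λ x → x ^ k * r x) (DegreeBelow-x^* k R) λ x → begin
  x ^ k * f x                     ≡⟨ cong (x ^ k *_) (f≗ x) ⟩
  x ^ k * (c * x ^ d + r x)       ≡⟨ regroup c (x ^ k) (x ^ d) (r x) ⟩
  c * (x ^ k * x ^ d) + x ^ k * r x ≡⟨ cong (λ p → c * p + x ^ k * r x) (sym (^-homo-* x k d)) ⟩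
  c * x ^ (k ℕ.+ d) + x ^ k * r x ∎
  where
  open ≡-Reasoning
  regroup : ∀ c p q a → p * (c * q + a) ≡ c * (p * q) + p * a
  regroup = solve-∀ ℚ-ring

LeadingTerm-* : ∀ {d e c c′ f g} → LeadingTerm d c f → LeadingTerm e c′ g →
                LeadingTerm (d ℕ.+ e) (c * c′) (λ x → f x * g x)
LeadingTerm-* {d} {e} {c} {c′} {f} {g} (leading r R f≗) (leading s S g≗) =
  leading lower
  (DegreeBelow-+ (DegreeBelow-+ (DegreeBelow-scale c (DegreeBelow-x^* d S))
                                (DegreeBelow-scale c′ (DegreeBelow-mono (ℕ.≤-reflexive (ℕ.+-comm e d)) (DegreeBelow-x^* e R))))
                 (DegreeBelow-* R S))
  λ x → begin
    f x * g x                              ≡⟨ cong₂ _*_ (f≗ x) (g≗ x) ⟩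
    (c * x ^ d + r x) * (c′ * x ^ e + s x) ≡⟨ expand c c′ (x ^ d) (x ^ e) (r x) (s x) ⟩
    c * c′ * (x ^ d * x ^ e) + lower x     ≡⟨ cong (λ p → c * c′ * p + lower x) (sym (^-homo-* x d e)) ⟩
    c * c′ * x ^ (d ℕ.+ e) + lower x       ∎
  where
  open ≡-Reasoning
  lower : ℚ → ℚ
  lower x = c * (x ^ d * s x) + c′ * (x ^ e * r x) + r x * s x
  expand : ∀ c c′ p q a b → (c * p + a) * (c′ * q + b) ≡ c * c′ * (p * q) + (c * (p * b) + c′ * (q * a) + a * b)
  expand = solve-∀ ℚ-ring

LeadingTerm-x^ : ∀ d → LeadingTerm d 1ℚ (_^ d)
LeadingTerm-x^ d = leading (λ _ → 0ℚ) (DegreeBelow-0 d) λ x → sym (trans (+-identityʳ _) (*-identityˡ _))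

LeadingTerm-[x+t]^ : ∀ t d → LeadingTerm d 1ℚ (λ x → (x + t) ^ d)
LeadingTerm-[x+t]^ t zero = LeadingTerm-x^ zero
LeadingTerm-[x+t]^ t (suc d) = LeadingTerm-* x+t (LeadingTerm-[x+t]^ t d)
  where
  x+t : LeadingTerm 1 1ℚ (λ x → x + t)
  x+t = leading (λ _ → t) (DegreeBelow-const t) λ x → identity x t
    where
    identity : ∀ x t → x + t ≡ 1ℚ * (x * 1ℚ) + t
    identity = solve-∀ ℚ-ring

LeadingTerm-shift : ∀ {d c f} t → LeadingTerm d c f → LeadingTerm d c (λ x → f (x + t))
LeadingTerm-shift {d} {c} t (leading r R f≗) =
  LeadingTerm-≗ (λ x → f≗ (x + t))
    (LeadingTerm-+lower
      (subst (λ c′ → LeadingTerm d c′ (λ x → c * (x + t) ^ d)) (*-identityʳ c) (LeadingTerm-scale c (LeadingTerm-[x+t]^ t d)))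
      (DegreeBelow-shift t R))

LeadingTerm-Δx^ : ∀ d → LeadingTerm d (ι (suc d)) (λ x → x ^ suc d - (x - 1ℚ) ^ suc d)
LeadingTerm-Δx^ zero = leading (λ _ → 0ℚ) (DegreeBelow-0 0)
  λ x → trans (identity x) (cong (λ m → m * 1ℚ + 0ℚ) (sym ι-1))
  where
  identity : ∀ x → x * 1ℚ - (x - 1ℚ) * 1ℚ ≡ 1ℚ * 1ℚ + 0ℚ
  identity = solve-∀ ℚ-ring
LeadingTerm-Δx^ (suc d) =
  subst (λ m → LeadingTerm (suc d) m (λ x → x ^ suc (suc d) - (x - 1ℚ) ^ suc (suc d))) (sym (ι-suc (suc d)))
    (LeadingTerm-≗ (λ x → identity x (x ^ suc d) ((x - 1ℚ) ^ suc d))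
      (LeadingTerm-+ (LeadingTerm-x* (LeadingTerm-Δx^ d)) (LeadingTerm-[x+t]^ (- 1ℚ) (suc d))))
  where
  identity : ∀ x p q → x * p - (x - 1ℚ) * q ≡ x * (p - q) + q
  identity = solve-∀ ℚ-ring

DegreeBelow-suc⇒LeadingTerm : ∀ {d h} → DegreeBelow (suc d) h → Σ ℚ λ a → LeadingTerm d a h
DegreeBelow-suc⇒LeadingTerm {zero} (deg-suc {g = g} a (deg-0 g≗0) h≗) =
  a , leading (λ _ → 0ℚ) (DegreeBelow-0 0) λ x → trans (h≗ x) (trans (cong (λ z → a + x * z) (g≗0 x)) (identity a x))
  where
  identity : ∀ a x → a + x * 0ℚ ≡ a * 1ℚ + 0ℚ
  identity = solve-∀ ℚ-ring
DegreeBelow-suc⇒LeadingTerm {suc d} (deg-suc {g = g} a G h≗) with DegreeBelow-suc⇒LeadingTerm G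
... | b , L = b , LeadingTerm-≗ (λ x → trans (h≗ x) (+-comm a (x * g x)))
                    (LeadingTerm-+lower (LeadingTerm-x* L) (DegreeBelow-mono (s≤s z≤n) (DegreeBelow-const a)))

-- h(0) = 0 kills the constant term; dividing by x and shifting by 1 gives a polynomial of lower degree,
-- with the same leading coefficient, that again vanishes on ℕ.
LeadingTerm-vanishing : ∀ {d c h} → LeadingTerm d c h → (∀ N → h (ι N) ≡ 0ℚ) → c ≡ 0ℚ
LeadingTerm-vanishing {zero} {c} {h} (leading r (deg-0 r≗0) h≗) h[N]≡0 = begin
  c                  ≡⟨ sym (trans (cong (c * 1ℚ +_) (r≗0 (ι 0))) (trans (+-identityʳ (c * 1ℚ)) (*-identityʳ c))) ⟩
  c * 1ℚ + r (ι 0)   ≡⟨ sym (h≗ (ι 0)) ⟩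
  h (ι 0)            ≡⟨ h[N]≡0 0 ⟩
  0ℚ                 ∎
  where open ≡-Reasoning
LeadingTerm-vanishing {suc d} {c} {h} (leading r (deg-suc {g = r′} a R′ r≗) h≗) h[N]≡0 =
  LeadingTerm-vanishing (LeadingTerm-shift 1ℚ (leading r′ R′ λ x → refl)) h′[N+1]≡0
  where
  open ≡-Reasoning
  h′ : ℚ → ℚ
  h′ x = c * x ^ d + r′ x

  a≡0 : a ≡ 0ℚ
  a≡0 = begin
    a                                          ≡⟨ sym (at-0 c (ι 0 ^ d) a (r′ (ι 0))) ⟩
    c * (0ℚ * ι 0 ^ d) + (a + 0ℚ * r′ (ι 0))   ≡⟨ cong (λ z → c * (z * ι 0 ^ d) + (a + z * r′ (ι 0))) (sym ι-0) ⟩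
    c * ι 0 ^ suc d + (a + ι 0 * r′ (ι 0))     ≡⟨ cong (c * ι 0 ^ suc d +_) (sym (r≗ (ι 0))) ⟩
    c * ι 0 ^ suc d + r (ι 0)                  ≡⟨ sym (h≗ (ι 0)) ⟩
    h (ι 0)                                    ≡⟨ h[N]≡0 0 ⟩
    0ℚ                                         ∎
    where
    at-0 : ∀ c p a q → c * (0ℚ * p) + (a + 0ℚ * q) ≡ a
    at-0 = solve-∀ ℚ-ring

  h≡x*h′ : ∀ x → h x ≡ x * h′ x
  h≡x*h′ x = begin
    h x                                  ≡⟨ h≗ x ⟩
    c * (x * x ^ d) + r x                ≡⟨ cong (c * (x * x ^ d) +_) (r≗ x) ⟩
    c * (x * x ^ d) + (a + x * r′ x)     ≡⟨ cong (λ z → c * (x * x ^ d) + (z + x * r′ x)) a≡0 ⟩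
    c * (x * x ^ d) + (0ℚ + x * r′ x)    ≡⟨ factor c x (x ^ d) (r′ x) ⟩
    x * h′ x                             ∎
    where
    factor : ∀ c x p q → c * (x * p) + (0ℚ + x * q) ≡ x * (c * p + q)
    factor = solve-∀ ℚ-ring

  h′[N+1]≡0 : ∀ N → h′ (ι N + 1ℚ) ≡ 0ℚ
  h′[N+1]≡0 N = subst (λ y → h′ y ≡ 0ℚ) (ι-suc N)
    (p*q≡0⇒q≡0 (ι-suc≢0 N) (trans (sym (h≡x*h′ (ι (suc N)))) (h[N]≡0 (suc N))))

LeadingTerm-unique : ∀ {d e c c′ f g} → LeadingTerm d c f → LeadingTerm e c′ g → (∀ N → f (ι N) ≡ g (ι N)) →
                     c ≢ 0ℚ → c′ ≢ 0ℚ → c ≡ c′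
LeadingTerm-unique {d} {e} F G f≡g c≢0 c′≢0 with ℕ.<-cmp d e
... | tri< d<e _ _ = ⊥-elim (c′≢0 (LeadingTerm-vanishing
        (LeadingTerm-+lower G (DegreeBelow-scale (- 1ℚ) (DegreeBelow-mono d<e (LeadingTerm⇒DegreeBelow F))))
        (λ N → p≡q⇒p-q≡0 (sym (f≡g N)))))
... | tri≈ _ refl _ = p-q≡0⇒p≡q (LeadingTerm-vanishing (LeadingTerm-+ F (LeadingTerm-scale (- 1ℚ) G))
        (λ N → p≡q⇒p-q≡0 (f≡g N)))
... | tri> _ _ e<d = ⊥-elim (c≢0 (LeadingTerm-vanishing
        (LeadingTerm-+lower F (DegreeBelow-scale (- 1ℚ) (DegreeBelow-mono e<d (LeadingTerm⇒DegreeBelow G))))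
        (λ N → p≡q⇒p-q≡0 (f≡g N))))

-- Partial sums

partialSum : ℕ → (ℚ → ℚ) → ℚ
partialSum zero f = 0ℚ
partialSum (suc N) f = partialSum N f + f (ι (suc N))

partialSum-cong : ∀ {f g} → (∀ x → f x ≡ g x) → ∀ N → partialSum N f ≡ partialSum N g
partialSum-cong f≗g zero = refl
partialSum-cong f≗g (suc N) = cong₂ _+_ (partialSum-cong f≗g N) (f≗g (ι (suc N)))

partialSum-0 : ∀ N → partialSum N (λ _ → 0ℚ) ≡ 0ℚ
partialSum-0 zero = refl
partialSum-0 (suc N) = trans (+-identityʳ _) (partialSum-0 N)

partialSum-+ : ∀ f g N → partialSum N (λ x → f x + g x) ≡ partialSum N f + partialSum N g
partialSum-+ f g zero = sym (+-identityʳ 0ℚ)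
partialSum-+ f g (suc N) =
  trans (cong (_+ (f (ι (suc N)) + g (ι (suc N)))) (partialSum-+ f g N))
        (+-interchange (partialSum N f) (partialSum N g) (f (ι (suc N))) (g (ι (suc N))))
  where
  +-interchange : ∀ a b c d → (a + b) + (c + d) ≡ (a + c) + (b + d)
  +-interchange = solve-∀ ℚ-ring

partialSum-scale : ∀ k f N → partialSum N (λ x → k * f x) ≡ k * partialSum N f
partialSum-scale k f zero = sym (*-zeroʳ k)
partialSum-scale k f (suc N) =
  trans (cong (_+ k * f (ι (suc N))) (partialSum-scale k f N)) (sym (*-distribˡ-+ k _ (f (ι (suc N)))))

partialSum-telescope : ∀ (g : ℚ → ℚ) N → partialSum N (λ x → g x - g (x - 1ℚ)) ≡ g (ι N) - g 0ℚ
partialSum-telescope g zero = trans (sym (+-inverseʳ (g 0ℚ))) (cong (λ z → g z - g 0ℚ) (sym ι-0))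
partialSum-telescope g (suc N) = begin
  partialSum N Δg + (g (ι (suc N)) - g (ι (suc N) - 1ℚ))
    ≡⟨ cong₂ (λ s y → s + (g (ι (suc N)) - g y)) (partialSum-telescope g N) (ι-suc-1 N) ⟩
  (g (ι N) - g 0ℚ) + (g (ι (suc N)) - g (ι N))
    ≡⟨ cancel (g (ι N)) (g 0ℚ) (g (ι (suc N))) ⟩
  g (ι (suc N)) - g 0ℚ ∎
  where
  open ≡-Reasoning
  Δg : ℚ → ℚ
  Δg x = g x - g (x - 1ℚ)
  cancel : ∀ a b c → (a - b) + (c - a) ≡ c - b
  cancel = solve-∀ ℚ-ring

record ExtendsTo (P : (ℚ → ℚ) → Set) (F : ℕ → ℚ) : Set where
  constructor extension
  field
    fun    : ℚ → ℚ
    has-P  : P fun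
    agrees : ∀ N → F N ≡ fun (ι N)

ExtendsTo-map : ∀ {P Q : (ℚ → ℚ) → Set} {F} → (∀ {f} → P f → Q f) → ExtendsTo P F → ExtendsTo Q F
ExtendsTo-map P⇒Q (extension f Pf agrees) = extension f (P⇒Q Pf) agrees

ExtendsTo-≗ : ∀ {P F G} → (∀ N → G N ≡ F N) → ExtendsTo P F → ExtendsTo P G
ExtendsTo-≗ G≗F (extension f Pf agrees) = extension f Pf (λ N → trans (G≗F N) (agrees N))

partialSum-DegreeBelow : ∀ d {h} → DegreeBelow d h → ExtendsTo (DegreeBelow (suc d)) (λ N → partialSum N h)
partialSum-x^ : ∀ e → ExtendsTo (LeadingTerm (suc e) (1/suc e)) (λ N → partialSum N (_^ e))
partialSum-LeadingTerm : ∀ e {c q} → LeadingTerm e c q →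
                         ExtendsTo (LeadingTerm (suc e) (c * 1/suc e)) (λ N → partialSum N q)

partialSum-DegreeBelow zero (deg-0 h≗0) =
  extension (λ _ → 0ℚ) (DegreeBelow-0 1) (λ N → trans (partialSum-cong h≗0 N) (partialSum-0 N))
partialSum-DegreeBelow (suc d) H =
  ExtendsTo-map LeadingTerm⇒DegreeBelow (partialSum-LeadingTerm d (proj₂ (DegreeBelow-suc⇒LeadingTerm H)))

partialSum-x^ e =
  extension (λ x → 1/suc e * (x ^ suc e + - 1ℚ * ρ x))
    (subst (λ c → LeadingTerm (suc e) c (λ x → 1/suc e * (x ^ suc e + - 1ℚ * ρ x))) (*-identityʳ (1/suc e))
      (LeadingTerm-scale (1/suc e) (LeadingTerm-+lower (LeadingTerm-x^ (suc e)) (DegreeBelow-scale (- 1ℚ) P))))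
    (λ N → m*p+r≡t⇒p≡[t-r]/m {m} {1/suc e} {partialSum N (_^ e)} {ρ (ι N)} (ι-suc*1/suc e) (telescoped N))
  where
  open ≡-Reasoning
  open LeadingTerm (LeadingTerm-Δx^ e) renaming (lower to r; lower-degree to R; expansion to Δ≗)
  open ExtendsTo (partialSum-DegreeBelow e R) renaming (fun to ρ; has-P to P; agrees to ρ-agrees)
  m = ι (suc e)
  0^[1+e]≡0 : 0ℚ ^ suc e ≡ 0ℚ
  0^[1+e]≡0 = *-zeroˡ (0ℚ ^ e)
  telescoped : ∀ N → m * partialSum N (_^ e) + ρ (ι N) ≡ ι N ^ suc e
  telescoped N = begin
    m * partialSum N (_^ e) + ρ (ι N)                 ≡⟨ cong₂ _+_ (sym (partialSum-scale m (_^ e) N)) (sym (ρ-agrees N)) ⟩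
    partialSum N (λ x → m * x ^ e) + partialSum N r   ≡⟨ sym (partialSum-+ (λ x → m * x ^ e) r N) ⟩
    partialSum N (λ x → m * x ^ e + r x)              ≡⟨ partialSum-cong (λ x → sym (Δ≗ x)) N ⟩
    partialSum N (λ x → x ^ suc e - (x - 1ℚ) ^ suc e) ≡⟨ partialSum-telescope (_^ suc e) N ⟩
    ι N ^ suc e - 0ℚ ^ suc e                          ≡⟨ cong (λ z → ι N ^ suc e - z) 0^[1+e]≡0 ⟩
    ι N ^ suc e - 0ℚ                                  ≡⟨ +-identityʳ (ι N ^ suc e) ⟩
    ι N ^ suc e                                       ∎

partialSum-LeadingTerm e {c} {q} (leading r R q≗) =
  extension (λ x → c * f x + g x) (LeadingTerm-+lower (LeadingTerm-scale c F) G) λ N → begin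
    partialSum N q                                     ≡⟨ partialSum-cong q≗ N ⟩
    partialSum N (λ x → c * x ^ e + r x)               ≡⟨ partialSum-+ (λ x → c * x ^ e) r N ⟩
    partialSum N (λ x → c * x ^ e) + partialSum N r    ≡⟨ cong (_+ partialSum N r) (partialSum-scale c (_^ e) N) ⟩
    c * partialSum N (_^ e) + partialSum N r           ≡⟨ cong₂ (λ s t → c * s + t) (f-agrees N) (g-agrees N) ⟩
    c * f (ι N) + g (ι N)                              ∎
  where
  open ≡-Reasoning
  open ExtendsTo (partialSum-x^ e) renaming (fun to f; has-P to F; agrees to f-agrees)
  open ExtendsTo (partialSum-DegreeBelow e R) renaming (fun to g; has-P to G; agrees to g-agrees)

-- Leading coefficients of sequences on ℕ

horner : List ℚ → ℚ → ℚ
horner [] x = 0ℚ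
horner (a ∷ as) x = a + x * horner as x

evalPoly≡horner : ∀ as N → evalPoly as N ≡ horner as (ι N)
evalPoly≡horner [] N = refl
evalPoly≡horner (a ∷ as) N = cong₂ (λ y z → a + y * z) (sym (ι≡/1 N)) (evalPoly≡horner as N)

horner-DegreeBelow : ∀ as → DegreeBelow (length as) (horner as)
horner-DegreeBelow [] = deg-0 (λ _ → refl)
horner-DegreeBelow (a ∷ as) = deg-suc a (horner-DegreeBelow as) (λ _ → refl)

horner-∷ʳ : ∀ as c x → horner (as ∷ʳ c) x ≡ c * x ^ length as + horner as x
horner-∷ʳ [] c x = identity c x
  where
  identity : ∀ c x → c + x * 0ℚ ≡ c * 1ℚ + 0ℚ
  identity = solve-∀ ℚ-ring
horner-∷ʳ (a ∷ as) c x = trans (cong (λ h → a + x * h) (horner-∷ʳ as c x)) (regroup a c x (x ^ length as) (horner as x))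
  where
  regroup : ∀ a c x p h → a + x * (c * p + h) ≡ c * (x * p) + (a + x * h)
  regroup = solve-∀ ℚ-ring

DegreeBelow⇒horner : ∀ {d f} → DegreeBelow d f → Σ (List ℚ) λ as → length as ≡ d × (∀ x → f x ≡ horner as x)
DegreeBelow⇒horner (deg-0 f≗0) = [] , refl , f≗0
DegreeBelow⇒horner (deg-suc a G f≗) with DegreeBelow⇒horner G
... | as , refl , g≗ = a ∷ as , refl , λ x → trans (f≗ x) (cong (λ h → a + x * h) (g≗ x))

horner-normal : ∀ as → (∀ x → horner as x ≡ 0ℚ)
                      ⊎ Σ (List ℚ) λ bs → Σ ℚ λ c → c ≢ 0ℚ × (∀ x → horner as x ≡ horner (bs ∷ʳ c) x)
horner-normal [] = inj₁ (λ _ → refl)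
horner-normal (a ∷ as) with horner-normal as | a ≟ 0ℚ
... | inj₂ (bs , c , c≢0 , as≗) | _ = inj₂ (a ∷ bs , c , c≢0 , λ x → cong (λ h → a + x * h) (as≗ x))
... | inj₁ as≗0 | yes refl =
  inj₁ (λ x → trans (cong (λ h → 0ℚ + x * h) (as≗0 x)) (trans (+-identityˡ (x * 0ℚ)) (*-zeroʳ x)))
... | inj₁ as≗0 | no a≢0 = inj₂ ([] , a , a≢0 , λ x → cong (λ h → a + x * h) (as≗0 x))

LeadCoeff⇒LeadingTerm : ∀ {F c} → LeadCoeff F c → Σ ℕ λ d → ExtendsTo (LeadingTerm d c) F
LeadCoeff⇒LeadingTerm {c = c} (as , _ , F≗) =
  length as , extension (horner (as ∷ʳ c)) (leading (horner as) (horner-DegreeBelow as) (horner-∷ʳ as c))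
                        (λ N → trans (F≗ N) (evalPoly≡horner (as ∷ʳ c) N))

LeadingTerm⇒LeadCoeff : ∀ {d c F} → c ≢ 0ℚ → ExtendsTo (LeadingTerm d c) F → LeadCoeff F c
LeadingTerm⇒LeadCoeff {c = c} {F} c≢0 (extension f (leading r R f≗) agrees) with DegreeBelow⇒horner R
... | as , refl , r≗ = as , c≢0 , λ N → begin
  F N                                           ≡⟨ agrees N ⟩
  f (ι N)                                       ≡⟨ f≗ (ι N) ⟩
  c * ι N ^ length as + r (ι N)                 ≡⟨ cong (c * ι N ^ length as +_) (r≗ (ι N)) ⟩
  c * ι N ^ length as + horner as (ι N)         ≡⟨ sym (horner-∷ʳ as c (ι N)) ⟩
  horner (as ∷ʳ c) (ι N)                        ≡⟨ sym (evalPoly≡horner (as ∷ʳ c) N) ⟩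
  evalPoly (as ∷ʳ c) N                          ∎
  where open ≡-Reasoning

LeadCoeff-unique : ∀ {F c c′} → LeadCoeff F c → LeadCoeff F c′ → c ≡ c′
LeadCoeff-unique F₁@(_ , c≢0 , _) F₂@(_ , c′≢0 , _)
  with LeadCoeff⇒LeadingTerm F₁ | LeadCoeff⇒LeadingTerm F₂
... | _ , extension f L agrees | _ , extension g L′ agrees′ =
  LeadingTerm-unique L L′ (λ N → trans (sym (agrees N)) (agrees′ N)) c≢0 c′≢0

LeadCoeff⇒nonvanishing : ∀ {F c} → LeadCoeff F c → ¬ (∀ N → F N ≡ 0ℚ)
LeadCoeff⇒nonvanishing F₁@(_ , c≢0 , _) F≡0 with LeadCoeff⇒LeadingTerm F₁
... | _ , extension f L agrees = c≢0 (LeadingTerm-vanishing L (λ N → trans (sym (agrees N)) (F≡0 N)))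

LeadCoeff-* : ∀ {F G H c c′} → LeadCoeff F c → LeadCoeff G c′ → (∀ N → H N ≡ F N * G N) → LeadCoeff H (c * c′)
LeadCoeff-* F₁@(_ , c≢0 , _) G₁@(_ , c′≢0 , _) H≡FG
  with LeadCoeff⇒LeadingTerm F₁ | LeadCoeff⇒LeadingTerm G₁
... | _ , extension f L agrees | _ , extension g L′ agrees′ =
  LeadingTerm⇒LeadCoeff (p*q≢0 c≢0 c′≢0)
    (extension (λ x → f x * g x) (LeadingTerm-* L L′) (λ N → trans (H≡FG N) (cong₂ _*_ (agrees N) (agrees′ N))))

nonvanishing⇒LeadCoeff : ∀ {d F} → ExtendsTo (DegreeBelow d) F → ¬ (∀ N → F N ≡ 0ℚ) → Σ ℚ (LeadCoeff F)
nonvanishing⇒LeadCoeff (extension f D agrees) F≢0 with DegreeBelow⇒horner D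
... | as , _ , f≗ with horner-normal as
...   | inj₁ as≗0 = ⊥-elim (F≢0 (λ N → trans (agrees N) (trans (f≗ (ι N)) (as≗0 (ι N)))))
...   | inj₂ (bs , c , c≢0 , as≗) =
  c , bs , c≢0 , λ N → trans (agrees N) (trans (f≗ (ι N)) (trans (as≗ (ι N)) (sym (evalPoly≡horner (bs ∷ʳ c) N))))

-- H⁻ turns ⋆ into the pointwise product

Hwℚ : Word → ℕ → ℚ
Hwℚ w N = ι (Hw w N)

H⁻-∷ : ∀ c w P N → H⁻ ((c , w) ∷ P) N ≡ c * Hwℚ w N + H⁻ P N
H⁻-∷ c w P N = cong (λ h → c * h + H⁻ P N) (sym (ι≡/1 (Hw w N)))

H⁻-word : ∀ w N → H⁻ (word w) N ≡ Hwℚ w N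
H⁻-word w N = trans (H⁻-∷ 1ℚ w [] N) (trans (+-identityʳ (1ℚ * Hwℚ w N)) (*-identityˡ (Hwℚ w N)))

H⁻-++ : ∀ P Q N → H⁻ (P ++ Q) N ≡ H⁻ P N + H⁻ Q N
H⁻-++ [] Q N = sym (+-identityˡ (H⁻ Q N))
H⁻-++ ((c , w) ∷ P) Q N = begin
  H⁻ ((c , w) ∷ (P ++ Q)) N        ≡⟨ H⁻-∷ c w (P ++ Q) N ⟩
  c * Hwℚ w N + H⁻ (P ++ Q) N       ≡⟨ cong (c * Hwℚ w N +_) (H⁻-++ P Q N) ⟩
  c * Hwℚ w N + (H⁻ P N + H⁻ Q N)   ≡⟨ sym (+-assoc (c * Hwℚ w N) (H⁻ P N) (H⁻ Q N)) ⟩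
  c * Hwℚ w N + H⁻ P N + H⁻ Q N     ≡⟨ cong (_+ H⁻ Q N) (sym (H⁻-∷ c w P N)) ⟩
  H⁻ ((c , w) ∷ P) N + H⁻ Q N      ∎
  where open ≡-Reasoning

Hwℚ-∷-suc : ∀ x w N → Hwℚ (x ∷ w) (suc N) ≡ Hwℚ (x ∷ w) N + ι (suc N) ^ x * Hwℚ w N
Hwℚ-∷-suc x w N =
  trans (ι-+ (Hw (x ∷ w) N) (suc N ℕ.^ x ℕ.* Hw w N))
        (cong (Hwℚ (x ∷ w) N +_) (trans (ι-* (suc N ℕ.^ x) (Hw w N)) (cong (_* Hwℚ w N) (ι-^ (suc N) x))))

H⁻-prefix-0 : ∀ x P → H⁻ (prefix x P) 0 ≡ 0ℚ
H⁻-prefix-0 x [] = refl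
H⁻-prefix-0 x ((c , w) ∷ P) =
  trans (H⁻-∷ c (x ∷ w) (prefix x P) 0)
        (trans (cong₂ (λ h s → c * h + s) ι-0 (H⁻-prefix-0 x P)) (trans (+-identityʳ (c * 0ℚ)) (*-zeroʳ c)))

H⁻-prefix-suc : ∀ x P N → H⁻ (prefix x P) (suc N) ≡ H⁻ (prefix x P) N + ι (suc N) ^ x * H⁻ P N
H⁻-prefix-suc x [] N = sym (trans (+-identityˡ (ι (suc N) ^ x * 0ℚ)) (*-zeroʳ (ι (suc N) ^ x)))
H⁻-prefix-suc x ((c , w) ∷ P) N = begin
  H⁻ (prefix x ((c , w) ∷ P)) (suc N)
    ≡⟨ H⁻-∷ c (x ∷ w) (prefix x P) (suc N) ⟩
  c * Hwℚ (x ∷ w) (suc N) + H⁻ (prefix x P) (suc N)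
    ≡⟨ cong₂ (λ h s → c * h + s) (Hwℚ-∷-suc x w N) (H⁻-prefix-suc x P N) ⟩
  c * (Hwℚ (x ∷ w) N + X * Hwℚ w N) + (H⁻ (prefix x P) N + X * H⁻ P N)
    ≡⟨ regroup c (Hwℚ (x ∷ w) N) X (Hwℚ w N) (H⁻ (prefix x P) N) (H⁻ P N) ⟩
  (c * Hwℚ (x ∷ w) N + H⁻ (prefix x P) N) + X * (c * Hwℚ w N + H⁻ P N)
    ≡⟨ sym (cong₂ (λ s t → s + X * t) (H⁻-∷ c (x ∷ w) (prefix x P) N) (H⁻-∷ c w P N)) ⟩
  H⁻ (prefix x ((c , w) ∷ P)) N + X * H⁻ ((c , w) ∷ P) N ∎
  where
  open ≡-Reasoning
  X = ι (suc N) ^ x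
  regroup : ∀ c a X b r s → c * (a + X * b) + (r + X * s) ≡ (c * a + r) + X * (c * b + s)
  regroup = solve-∀ ℚ-ring

H⁻-⋆-∷ : ∀ i u j v N → H⁻ ((i ∷ u) ⋆ (j ∷ v)) N ≡
         H⁻ (prefix j ((i ∷ u) ⋆ v)) N + (H⁻ (prefix i (u ⋆ (j ∷ v))) N + H⁻ (prefix (i ℕ.+ j) (u ⋆ v)) N)
H⁻-⋆-∷ i u j v N =
  trans (H⁻-++ (prefix j ((i ∷ u) ⋆ v)) _ N)
        (cong (H⁻ (prefix j ((i ∷ u) ⋆ v)) N +_) (H⁻-++ (prefix i (u ⋆ (j ∷ v))) (prefix (i ℕ.+ j) (u ⋆ v)) N))

H⁻-⋆ : ∀ N u v → H⁻ (u ⋆ v) N ≡ Hwℚ u N * Hwℚ v N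
H⁻-⋆ N [] v = trans (H⁻-word v N) (sym (trans (cong (_* Hwℚ v N) ι-1) (*-identityˡ (Hwℚ v N))))
H⁻-⋆ N u@(_ ∷ _) [] = trans (H⁻-word u N) (sym (trans (cong (Hwℚ u N *_) ι-1) (*-identityʳ (Hwℚ u N))))
H⁻-⋆ zero (i ∷ u) (j ∷ v) = begin
  H⁻ ((i ∷ u) ⋆ (j ∷ v)) 0
    ≡⟨ H⁻-⋆-∷ i u j v 0 ⟩
  H⁻ (prefix j ((i ∷ u) ⋆ v)) 0 + (H⁻ (prefix i (u ⋆ (j ∷ v))) 0 + H⁻ (prefix (i ℕ.+ j) (u ⋆ v)) 0)
    ≡⟨ cong₂ _+_ (H⁻-prefix-0 j ((i ∷ u) ⋆ v))
                 (cong₂ _+_ (H⁻-prefix-0 i (u ⋆ (j ∷ v))) (H⁻-prefix-0 (i ℕ.+ j) (u ⋆ v))) ⟩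
  0ℚ + (0ℚ + 0ℚ)
    ≡⟨ sym (cong₂ _*_ ι-0 ι-0) ⟩
  ι 0 * ι 0 ∎
  where open ≡-Reasoning
H⁻-⋆ (suc N) (i ∷ u) (j ∷ v) = begin
  H⁻ (a ⋆ b) (suc N)
    ≡⟨ H⁻-⋆-∷ i u j v (suc N) ⟩
  H⁻ (prefix j (a ⋆ v)) (suc N) + (H⁻ (prefix i (u ⋆ b)) (suc N) + H⁻ (prefix (i ℕ.+ j) (u ⋆ v)) (suc N))
    ≡⟨ cong₂ _+_ (H⁻-prefix-suc j (a ⋆ v) N)
                 (cong₂ _+_ (H⁻-prefix-suc i (u ⋆ b) N) (H⁻-prefix-suc (i ℕ.+ j) (u ⋆ v) N)) ⟩
  (A + Xʲ * H⁻ (a ⋆ v) N) + ((B + Xⁱ * H⁻ (u ⋆ b) N) + (C + X ^ (i ℕ.+ j) * H⁻ (u ⋆ v) N))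
    ≡⟨ cong₂ (λ p q → (A + Xʲ * p) + q) (H⁻-⋆ N a v)
         (cong₂ (λ p q → (B + Xⁱ * p) + (C + q)) (H⁻-⋆ N u b) (cong₂ _*_ (^-homo-* X i j) (H⁻-⋆ N u v))) ⟩
  (A + Xʲ * (ha * hv)) + ((B + Xⁱ * (hu * hb)) + (C + Xⁱ * Xʲ * (hu * hv)))
    ≡⟨ regroup A B C Xⁱ Xʲ ha hb hu hv ⟩
  (A + (B + C)) + cross
    ≡⟨ cong (_+ cross) (trans (sym (H⁻-⋆-∷ i u j v N)) (H⁻-⋆ N a b)) ⟩
  ha * hb + cross
    ≡⟨ factor Xⁱ Xʲ ha hb hu hv ⟩
  (ha + Xⁱ * hu) * (hb + Xʲ * hv)
    ≡⟨ sym (cong₂ _*_ (Hwℚ-∷-suc i u N) (Hwℚ-∷-suc j v N)) ⟩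
  Hwℚ a (suc N) * Hwℚ b (suc N) ∎
  where
  open ≡-Reasoning
  a = i ∷ u
  b = j ∷ v
  X = ι (suc N)
  Xⁱ = X ^ i
  Xʲ = X ^ j
  ha = Hwℚ a N
  hb = Hwℚ b N
  hu = Hwℚ u N
  hv = Hwℚ v N
  A = H⁻ (prefix j (a ⋆ v)) N
  B = H⁻ (prefix i (u ⋆ b)) N
  C = H⁻ (prefix (i ℕ.+ j) (u ⋆ v)) N
  cross = Xʲ * (ha * hv) + Xⁱ * (hu * hb) + Xⁱ * Xʲ * (hu * hv)
  regroup : ∀ A B C p q a b u v →
            (A + q * (a * v)) + ((B + p * (u * b)) + (C + p * q * (u * v))) ≡
            (A + (B + C)) + (q * (a * v) + p * (u * b) + p * q * (u * v))
  regroup = solve-∀ ℚ-ring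
  factor : ∀ p q a b u v → a * b + (q * (a * v) + p * (u * b) + p * q * (u * v)) ≡ (a + p * u) * (b + q * v)
  factor = solve-∀ ℚ-ring

H⁻-map-scale : ∀ (f : ℚ × Word → ℚ × Word) k P N → (∀ c u → f (c , u) ≡ (k * c , u)) →
               H⁻ (map f P) N ≡ k * H⁻ P N
H⁻-map-scale f k [] N _ = sym (*-zeroʳ k)
H⁻-map-scale f k ((c , u) ∷ P) N f≡ = begin
  H⁻ (f (c , u) ∷ map f P) N             ≡⟨ cong (λ t → H⁻ (t ∷ map f P) N) (f≡ c u) ⟩
  H⁻ ((k * c , u) ∷ map f P) N           ≡⟨ H⁻-∷ (k * c) u (map f P) N ⟩
  k * c * Hwℚ u N + H⁻ (map f P) N        ≡⟨ cong (k * c * Hwℚ u N +_) (H⁻-map-scale f k P N f≡) ⟩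
  k * c * Hwℚ u N + k * H⁻ P N            ≡⟨ regroup k c (Hwℚ u N) (H⁻ P N) ⟩
  k * (c * Hwℚ u N + H⁻ P N)              ≡⟨ cong (k *_) (sym (H⁻-∷ c u P N)) ⟩
  k * H⁻ ((c , u) ∷ P) N                 ∎
  where
  open ≡-Reasoning
  regroup : ∀ k c h s → k * c * h + k * s ≡ k * (c * h + s)
  regroup = solve-∀ ℚ-ring

H⁻-concatMap : ∀ (g : ℚ × Word → Poly) z P N → (∀ c w → H⁻ (g (c , w)) N ≡ c * Hwℚ w N * z) →
               H⁻ (concatMap g P) N ≡ H⁻ P N * z
H⁻-concatMap g z [] N _ = sym (*-zeroˡ z)
H⁻-concatMap g z ((c , w) ∷ P) N g≡ = begin
  H⁻ (g (c , w) ++ concatMap g P) N           ≡⟨ H⁻-++ (g (c , w)) (concatMap g P) N ⟩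
  H⁻ (g (c , w)) N + H⁻ (concatMap g P) N     ≡⟨ cong₂ _+_ (g≡ c w) (H⁻-concatMap g z P N g≡) ⟩
  c * Hwℚ w N * z + H⁻ P N * z                 ≡⟨ sym (*-distribʳ-+ z (c * Hwℚ w N) (H⁻ P N)) ⟩
  (c * Hwℚ w N + H⁻ P N) * z                   ≡⟨ cong (_* z) (sym (H⁻-∷ c w P N)) ⟩
  H⁻ ((c , w) ∷ P) N * z                      ∎
  where open ≡-Reasoning

H⁻-⋆ᴾ : ∀ P Q N → H⁻ (P ⋆ᴾ Q) N ≡ H⁻ P N * H⁻ Q N
H⁻-⋆ᴾ P Q N = H⁻-concatMap _ (H⁻ Q N) P N λ a w →
  trans (H⁻-concatMap _ (a * Hwℚ w N) Q N λ b v →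
           trans (H⁻-map-scale _ (a * b) (w ⋆ v) N (λ _ _ → refl))
                 (trans (cong (a * b *_) (H⁻-⋆ N w v)) (regroup a b (Hwℚ w N) (Hwℚ v N))))
        (*-comm (H⁻ Q N) (a * Hwℚ w N))
  where
  regroup : ∀ a b h h′ → a * b * (h * h′) ≡ b * h′ * (a * h)
  regroup = solve-∀ ℚ-ring

-- Leading coefficients of H⁻_w and of shuffles

weight : Word → ℕ
weight [] = 0
weight (s ∷ w) = suc (s ℕ.+ weight w)

C⁻ : Word → ℚ
C⁻ [] = 1ℚ
C⁻ (s ∷ w) = C⁻ w * 1/suc (s ℕ.+ weight w)

C⁻≢0 : ∀ w → C⁻ w ≢ 0ℚ
C⁻≢0 [] = 1≢0
C⁻≢0 (s ∷ w) = p*q≢0 (C⁻≢0 w) (1/suc≢0 (s ℕ.+ weight w))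

ι-sumTo : ∀ N f (q : ℚ → ℚ) → (∀ n → ι (f (suc n)) ≡ q (ι (suc n))) → ι (sumTo N f) ≡ partialSum N q
ι-sumTo zero f q f≡q = ι-0
ι-sumTo (suc N) f q f≡q = trans (ι-+ (sumTo N f) (f (suc N))) (cong₂ _+_ (ι-sumTo N f q f≡q) (f≡q N))

Hwℚ-LeadingTerm : ∀ w → ExtendsTo (LeadingTerm (weight w) (C⁻ w)) (Hwℚ w)
Hwℚ-LeadingTerm [] = extension (λ _ → 1ℚ) (LeadingTerm-x^ 0) (λ _ → ι-1)
Hwℚ-LeadingTerm (s ∷ w) =
  ExtendsTo-≗ (λ N → ι-sumTo N (λ n → n ℕ.^ s ℕ.* Hw w (n ℕ.∸ 1)) _ summand)
    (partialSum-LeadingTerm (s ℕ.+ weight w) (LeadingTerm-x^* s (LeadingTerm-shift (- 1ℚ) L)))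
  where
  open ExtendsTo (Hwℚ-LeadingTerm w) renaming (fun to f; has-P to L; agrees to f-agrees)
  summand : ∀ n → ι (suc n ℕ.^ s ℕ.* Hw w n) ≡ ι (suc n) ^ s * f (ι (suc n) - 1ℚ)
  summand n = trans (ι-* (suc n ℕ.^ s) (Hw w n))
                    (cong₂ _*_ (ι-^ (suc n) s) (trans (f-agrees n) (cong f (sym (ι-suc-1 n)))))

H⁻-word-LeadCoeff : ∀ w → LeadCoeff (H⁻ (word w)) (C⁻ w)
H⁻-word-LeadCoeff w = LeadingTerm⇒LeadCoeff (C⁻≢0 w) (ExtendsTo-≗ (H⁻-word w) (Hwℚ-LeadingTerm w))

H⁻-DegreeBelow : ∀ P → Σ ℕ λ d → ExtendsTo (DegreeBelow d) (H⁻ P)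
H⁻-DegreeBelow [] = 0 , extension (λ _ → 0ℚ) (DegreeBelow-0 0) (λ _ → refl)
H⁻-DegreeBelow ((c , w) ∷ P) with H⁻-DegreeBelow P
... | d , extension g G g-agrees =
  suc (weight w) ℕ.+ d ,
  extension (λ x → c * f x + g x)
    (DegreeBelow-+ (DegreeBelow-mono (ℕ.m≤m+n (suc (weight w)) d) (DegreeBelow-scale c (LeadingTerm⇒DegreeBelow L)))
                   (DegreeBelow-mono (ℕ.m≤n+m d (suc (weight w))) G))
    (λ N → trans (H⁻-∷ c w P N) (cong₂ (λ h s → c * h + s) (f-agrees N) (g-agrees N)))
  where
  open ExtendsTo (Hwℚ-LeadingTerm w) renaming (fun to f; has-P to L; agrees to f-agrees)

Homogeneous : ℕ → Poly → Set
Homogeneous d = All (λ t → weight (proj₂ t) ≡ d)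

leadSum : Poly → ℚ
leadSum [] = 0ℚ
leadSum ((c , u) ∷ P) = c * C⁻ u + leadSum P

Homogeneous-LeadingTerm : ∀ {d} P → Homogeneous d P → ExtendsTo (LeadingTerm d (leadSum P)) (H⁻ P)
Homogeneous-LeadingTerm {d} [] [] =
  extension (λ _ → 0ℚ)
    (leading (λ _ → 0ℚ) (DegreeBelow-0 d) (λ x → sym (trans (+-identityʳ (0ℚ * x ^ d)) (*-zeroˡ (x ^ d)))))
    (λ _ → refl)
Homogeneous-LeadingTerm ((c , u) ∷ P) (refl ∷ P-hom) with Homogeneous-LeadingTerm P P-hom
... | extension g G g-agrees =
  extension (λ x → c * f x + g x) (LeadingTerm-+ (LeadingTerm-scale c L) G)
    (λ N → trans (H⁻-∷ c u P N) (cong₂ (λ h s → c * h + s) (f-agrees N) (g-agrees N)))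
  where
  open ExtendsTo (Hwℚ-LeadingTerm u) renaming (fun to f; has-P to L; agrees to f-agrees)

prefix-Homogeneous : ∀ x {d} P → Homogeneous d P → Homogeneous (suc (x ℕ.+ d)) (prefix x P)
prefix-Homogeneous x [] [] = []
prefix-Homogeneous x ((c , u) ∷ P) (refl ∷ P-hom) = refl ∷ prefix-Homogeneous x P P-hom

leadSum-++ : ∀ P Q → leadSum (P ++ Q) ≡ leadSum P + leadSum Q
leadSum-++ [] Q = sym (+-identityˡ (leadSum Q))
leadSum-++ ((c , u) ∷ P) Q = trans (cong (c * C⁻ u +_) (leadSum-++ P Q)) (sym (+-assoc (c * C⁻ u) (leadSum P) (leadSum Q)))

leadSum-prefix : ∀ x {d} P → Homogeneous d P → leadSum (prefix x P) ≡ leadSum P * 1/suc (x ℕ.+ d)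
leadSum-prefix x {d} [] [] = sym (*-zeroˡ (1/suc (x ℕ.+ d)))
leadSum-prefix x ((c , u) ∷ P) (refl ∷ P-hom) =
  trans (cong (c * (C⁻ u * 1/suc (x ℕ.+ weight u)) +_) (leadSum-prefix x P P-hom))
        (regroup c (C⁻ u) (1/suc (x ℕ.+ weight u)) (leadSum P))
  where
  regroup : ∀ c w i s → c * (w * i) + s * i ≡ (c * w + s) * i
  regroup = solve-∀ ℚ-ring

⧢-Homogeneous : ∀ w v → Homogeneous (weight w ℕ.+ weight v) (w ⧢ v)
⧢-Homogeneous [] v = refl ∷ []
⧢-Homogeneous (x ∷ u) [] = sym (ℕ.+-identityʳ (weight (x ∷ u))) ∷ []
⧢-Homogeneous (x ∷ u) (y ∷ v) =
  ++⁺ (subst (λ d → Homogeneous d (prefix x (u ⧢ (y ∷ v)))) (left x y (weight u) (weight v))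
             (prefix-Homogeneous x (u ⧢ (y ∷ v)) (⧢-Homogeneous u (y ∷ v))))
      (subst (λ d → Homogeneous d (prefix y ((x ∷ u) ⧢ v))) (right x y (weight u) (weight v))
             (prefix-Homogeneous y ((x ∷ u) ⧢ v) (⧢-Homogeneous (x ∷ u) v)))
  where
  left : ∀ x y a b → suc (x ℕ.+ (a ℕ.+ suc (y ℕ.+ b))) ≡ suc (x ℕ.+ a) ℕ.+ suc (y ℕ.+ b)
  left = ℕ-Solver.solve-∀
  right : ∀ x y a b → suc (y ℕ.+ (suc (x ℕ.+ a) ℕ.+ b)) ≡ suc (x ℕ.+ a) ℕ.+ suc (y ℕ.+ b)
  right = ℕ-Solver.solve-∀

1/suc-sum : ∀ m n → 1/suc n * 1/suc (m ℕ.+ suc n) + 1/suc m * 1/suc (m ℕ.+ suc n) ≡ 1/suc m * 1/suc n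
1/suc-sum m n = reciprocal-sum {ι (suc m)} {ι (suc n)} {1/suc m} {1/suc n} {1/suc (m ℕ.+ suc n)} (ι-suc*1/suc m) (ι-suc*1/suc n)
  (subst (λ s → s * 1/suc (m ℕ.+ suc n) ≡ 1ℚ) (ι-+ (suc m) (suc n)) (ι-suc*1/suc (m ℕ.+ suc n)))

⧢-leadSum : ∀ w v → leadSum (w ⧢ v) ≡ C⁻ w * C⁻ v
⧢-leadSum [] v = +-identityʳ (1ℚ * C⁻ v)
⧢-leadSum (x ∷ u) [] = trans (+-identityʳ (1ℚ * C⁻ (x ∷ u))) (*-comm 1ℚ (C⁻ (x ∷ u)))
⧢-leadSum (x ∷ u) (y ∷ v) = begin
  leadSum (prefix x P₁ ++ prefix y P₂)
    ≡⟨ leadSum-++ (prefix x P₁) (prefix y P₂) ⟩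
  leadSum (prefix x P₁) + leadSum (prefix y P₂)
    ≡⟨ cong₂ _+_ (leadSum-prefix x P₁ (⧢-Homogeneous u (y ∷ v))) (leadSum-prefix y P₂ (⧢-Homogeneous (x ∷ u) v)) ⟩
  leadSum P₁ * 1/suc (x ℕ.+ (weight u ℕ.+ suc B)) + leadSum P₂ * 1/suc (y ℕ.+ (suc A ℕ.+ weight v))
    ≡⟨ cong₂ (λ i j → leadSum P₁ * 1/suc i + leadSum P₂ * 1/suc j)
             (sym (ℕ.+-assoc x (weight u) (suc B))) (reindex x y (weight u) (weight v)) ⟩
  leadSum P₁ * r + leadSum P₂ * r
    ≡⟨ cong₂ (λ s t → s * r + t * r) (⧢-leadSum u (y ∷ v)) (⧢-leadSum (x ∷ u) v) ⟩
  C⁻ u * (C⁻ v * q) * r + C⁻ u * p * C⁻ v * r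
    ≡⟨ regroup (C⁻ u) (C⁻ v) p q r ⟩
  C⁻ u * C⁻ v * (q * r + p * r)
    ≡⟨ cong (C⁻ u * C⁻ v *_) (1/suc-sum A B) ⟩
  C⁻ u * C⁻ v * (p * q)
    ≡⟨ regroup′ (C⁻ u) (C⁻ v) p q ⟩
  C⁻ u * p * (C⁻ v * q) ∎
  where
  open ≡-Reasoning
  P₁ = u ⧢ (y ∷ v)
  P₂ = (x ∷ u) ⧢ v
  A = x ℕ.+ weight u
  B = y ℕ.+ weight v
  p = 1/suc A
  q = 1/suc B
  r = 1/suc (A ℕ.+ suc B)
  reindex : ∀ x y a b → y ℕ.+ (suc (x ℕ.+ a) ℕ.+ b) ≡ (x ℕ.+ a) ℕ.+ suc (y ℕ.+ b)
  reindex = ℕ-Solver.solve-∀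
  regroup : ∀ a b p q r → a * (b * q) * r + a * p * b * r ≡ a * b * (q * r + p * r)
  regroup = solve-∀ ℚ-ring
  regroup′ : ∀ a b p q → a * b * (p * q) ≡ a * p * (b * q)
  regroup′ = solve-∀ ℚ-ring

H⁻-⧢-LeadCoeff : ∀ w v → LeadCoeff (H⁻ (w ⧢ v)) (C⁻ w * C⁻ v)
H⁻-⧢-LeadCoeff w v =
  LeadingTerm⇒LeadCoeff (p*q≢0 (C⁻≢0 w) (C⁻≢0 v))
    (subst (λ c → ExtendsTo (LeadingTerm (weight w ℕ.+ weight v) c) (H⁻ (w ⧢ v))) (⧢-leadSum w v)
      (Homogeneous-LeadingTerm (w ⧢ v) (⧢-Homogeneous w v)))

H⁻-word-nonvanishing : ∀ w → ¬ InKer (word w)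
H⁻-word-nonvanishing w = LeadCoeff⇒nonvanishing (H⁻-word-LeadCoeff w)

H⁻-⋆ᴾ-nonvanishing : ∀ P Q → ¬ InKer P → ¬ InKer Q → ¬ InKer (P ⋆ᴾ Q)
H⁻-⋆ᴾ-nonvanishing P Q P∉ker Q∉ker =
  LeadCoeff⇒nonvanishing (LeadCoeff-* (proj₂ (nonvanishing⇒LeadCoeff (proj₂ (H⁻-DegreeBelow P)) P∉ker))
                                      (proj₂ (nonvanishing⇒LeadCoeff (proj₂ (H⁻-DegreeBelow Q)) Q∉ker))
                                      (H⁻-⋆ᴾ P Q))

corollary1 :
    ((w v : Word) (c₁ c₂ : ℚ) → LeadCoeff (H⁻ (word w)) c₁ → LeadCoeff (H⁻ (word v)) c₂ →
      LeadCoeff (H⁻ (w ⧢ v)) (c₁ * c₂) × LeadCoeff (H⁻ (w ⋆ v)) (c₁ * c₂))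
    × ((P Q : Poly) → ¬ InKer P → ¬ InKer Q → (c₁ c₂ : ℚ) →
        LeadCoeff (H⁻ P) c₁ → LeadCoeff (H⁻ Q) c₂ → LeadCoeff (H⁻ (P ⋆ᴾ Q)) (c₁ * c₂))
    × ((P Q : Poly) → ¬ InKer P → ¬ InKer Q → ¬ InKer (P ⋆ᴾ Q))
    × ¬ InKer 1P
    × ((w : Word) → ¬ InKer (word w))
corollary1 =
  (λ w v c₁ c₂ L₁ L₂ →
    subst₂ (λ a b → LeadCoeff (H⁻ (w ⧢ v)) (a * b))
           (LeadCoeff-unique (H⁻-word-LeadCoeff w) L₁) (LeadCoeff-unique (H⁻-word-LeadCoeff v) L₂)
           (H⁻-⧢-LeadCoeff w v) ,
    LeadCoeff-* L₁ L₂ (λ N → trans (H⁻-⋆ N w v) (sym (cong₂ _*_ (H⁻-word w N) (H⁻-word v N))))) ,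
  (λ P Q _ _ c₁ c₂ L₁ L₂ → LeadCoeff-* L₁ L₂ (H⁻-⋆ᴾ P Q)) ,
  H⁻-⋆ᴾ-nonvanishing ,
  H⁻-word-nonvanishing [] ,
  H⁻-word-nonvanishing
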